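{- Let $n\ge1$. Every facet of ${\cal H}(B(n))$ is of the form $$E(B(n))\cup\{(p,q)\mid \{p,q\}\in T\}\cup\{(p,q)\mid (p,q)\in O\},$$ where $T$ is a spanning tree of the complete graph $K_n$ on $\{1,\dots,n\}$ and $O$ is an acyclic orientation of $K_n\setminus T$.
   Context: For $n\ge1$, $B(n)$ denotes the aperiodic Brandt semigroup: the set $(\{1,\dots,n\}\times\{1,\dots,n\})\cup\{0\}$, where $0$ is a zero element and $(i,j)(k,l)=(i,l)$ if $j=k$ and $(i,j)(k,l)=0$ otherwise. Its set of idempotents is $E(B(n))=\{0\}\cup\{(i,i)\mid1\le i\le n\}$. For $Y\subseteq B(n)$, $Y^+$ denotes the subsemigroup generated by $Y$ ($\emptyset^+=\emptyset$). The subsemigroup complex ${\cal H}(B(n))$ has vertex set $B(n)$, and a subset $X$ is a face iff it admits an enumeration $x_1,\dots,x_k$ with $\emptyset\subset\{x_1\}^+\subset\cdots\subset\{x_1,\dots,x_k\}^+$ (all inclusions strict); a facet is a maximal face. $K_n$ is the complete undirected graph (no loops) on $\{1,\dots,n\}$; a spanning tree is a subtree containing all $n$ vertices; $K_n\setminus T$ is the graph obtained from $K_n$ by removing the edges of $T$. An orientation of an undirected graph $(V,E)$ is a relation $O\subseteq V\times V$ such that $(p,q)\mapsto\{p,q\}$ is a bijection $O\to E$; it is acyclic if it contains no directed cycle. -}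

module Defs where

open import Level using (0ℓ)
open import Data.Nat using (ℕ; suc; _≤_)
open import Data.Fin using (Fin; toℕ; _≟_)
open import Data.List using (List; []; _∷_; take; length)
open import Data.List.Membership.Propositional using (_∈_)
open import Data.List.Relation.Unary.All using (All)
open import Data.List.Relation.Unary.Unique.Propositional using (Unique)
open import Data.Product using (Σ; ∃; ∃-syntax; _×_; _,_)
open import Data.Sum using (_⊎_)
open import Function.Bundles using (_⇔_)
open import Relation.Nullary using (¬_; yes; no)
open import Relation.Binary.PropositionalEquality using (_≡_; _≢_)
open import Relation.Binary.Construct.Closure.ReflexiveTransitive using (Star)
open import Relation.Binary.Construct.Closure.Transitive using (TransClosure)

-- The aperiodic Brandt semigroup B(n); indices 1..n are rendered as Fin n.

data B (n : ℕ) : Set where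
  zero : B n
  pair : Fin n → Fin n → B n

infixl 7 _·_
_·_ : ∀ {n} → B n → B n → B n
zero     · _          = zero
pair _ _ · zero       = zero
pair i j · pair k l with j ≟ k
... | yes _ = pair i l
... | no  _ = zero

E : ∀ {n} → B n → Set
E x = x · x ≡ x

SubsetB : ℕ → Set₁
SubsetB n = B n → Set

_⊆_ : ∀ {n} → SubsetB n → SubsetB n → Set
X ⊆ Y = ∀ x → X x → Y x

_⊂_ : ∀ {n} → SubsetB n → SubsetB n → Set
X ⊂ Y = X ⊆ Y × ∃[ y ] (Y y × ¬ X y)

prod : ∀ {n} → B n → List (B n) → B n
prod x []       = x
prod x (y ∷ ys) = x · prod y ys

-- {y₁,…,yₘ}⁺ : the subsemigroup generated by the elements of a list
-- (all finite nonempty products of generators; empty for the empty list).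
Gen : ∀ {n} → List (B n) → SubsetB n
Gen ys x = ∃[ z ] ∃[ zs ] (z ∈ ys × All (_∈ ys) zs × prod z zs ≡ x)

-- xs = x₁,…,xₖ satisfies ∅ ⊂ {x₁}⁺ ⊂ {x₁,x₂}⁺ ⊂ ⋯ ⊂ {x₁,…,xₖ}⁺
StrictChain : ∀ {n} → List (B n) → Set
StrictChain xs = (i : Fin (length xs)) →
  Gen (take (toℕ i) xs) ⊂ Gen (take (suc (toℕ i)) xs)

Enumerates : ∀ {n} → List (B n) → SubsetB n → Set
Enumerates xs X = Unique xs × (∀ x → X x ⇔ (x ∈ xs))

IsFace : ∀ {n} → SubsetB n → Set
IsFace X = ∃[ xs ] (Enumerates xs X × StrictChain xs)

IsFacet : ∀ {n} → SubsetB n → Set₁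
IsFacet X = IsFace X × ((Y : SubsetB _) → IsFace Y → X ⊆ Y → Y ⊆ X)

-- Undirected graphs on {1..n} (= Fin n): a symmetric irreflexive relation,
-- i.e. E p q holds iff the 2-element set {p,q} is an edge.

Graph : ℕ → Set₁
Graph n = Fin n → Fin n → Set

IsSimpleGraph : ∀ {n} → Graph n → Set
IsSimpleGraph G = (∀ p q → G p q → G q p) × (∀ p → ¬ G p p)

K : (n : ℕ) → Graph n
K n p q = p ≢ q

_⊆G_ : ∀ {n} → Graph n → Graph n → Set
G ⊆G H = ∀ p q → G p q → H p q

_∖_ : ∀ {n} → Graph n → Graph n → Graph n
(G ∖ T) p q = G p q × ¬ T p q

Connected : ∀ {n} → Graph n → Set
Connected G = ∀ p q → Star G p q

-- a cycle: distinct vertices v₀,v₁,…,vₖ (k ≥ 2) with consecutive vertices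
-- adjacent and vₖ adjacent to v₀.
-- CycleFrom G v₀ w ws : walk from w along ws and then back to v₀.
CycleFrom : ∀ {n} → Graph n → Fin n → Fin n → List (Fin n) → Set
CycleFrom G v₀ w []       = G w v₀
CycleFrom G v₀ w (u ∷ us) = G w u × CycleFrom G v₀ u us

HasCycle : ∀ {n} → Graph n → Set
HasCycle G = ∃[ v₀ ] ∃[ vs ]
  (2 ≤ length vs × Unique (v₀ ∷ vs) × CycleFrom G v₀ v₀ vs)

IsSpanningTree : (n : ℕ) → Graph n → Set
IsSpanningTree n T =
  IsSimpleGraph T × T ⊆G K n × Connected T × ¬ HasCycle T

-- O ⊆ V × V is an orientation of G: (p,q) ↦ {p,q} is a bijection O → E(G).
-- (well-defined: O p q → G p q; injective: not both O p q and O q p;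
--  surjective: every edge {p,q} comes from (p,q) or (q,p).)
IsOrientation : ∀ {n} → Graph n → (Fin n → Fin n → Set) → Set
IsOrientation G O =
  (∀ p q → O p q → G p q) ×
  (∀ p q → O p q → O q p → p ≡ q) ×
  (∀ p q → G p q → O p q ⊎ O q p)

IsAcyclic : ∀ {n} → (Fin n → Fin n → Set) → Set
IsAcyclic O = ∀ v → ¬ TransClosure O v v

FacetShape : ∀ {n} → Graph n → (Fin n → Fin n → Set) → SubsetB n
FacetShape T O x =
  E x ⊎ (∃[ p ] ∃[ q ] (x ≡ pair p q × T p q))
      ⊎ (∃[ p ] ∃[ q ] (x ≡ pair p q × O p q))

module Submission where

-- A face is a set enumerated as a strict chain, i.e. each element lies outside
-- the subsemigroup generated by the earlier ones.  In B(n) a pair (p , q) is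
-- generated by a list L iff the digraph with an arc p → q for every pair of L
-- has a nonempty walk from p to q.  Hence the non-loop pairs of a face form a
-- valid edge sequence (no edge is implied by a path through earlier edges),
-- and conversely 0, all idempotents (i , i) and any valid sequence form a face.
-- So a facet contains 0 and the idempotents, and its other pairs form a
-- maximal valid sequence on {1..n}.
--
-- The core is a structure theorem for maximal valid sequences over any vertex
-- type with decidable equality, by induction on the length: the latest edge
-- a → b cuts the vertices into those reachable from a along older edges and the
-- rest; both parts are again maximal, and every edge across the cut is present.
-- Consequently the two-way edges form a spanning tree T and the one-way edges
-- an acyclic orientation O of Kₙ ∖ T, which gives the theorem.

open import Defs
open import Data.Nat using (ℕ; suc; _≤_; s≤s)
open import Data.Nat.Properties using (≤-refl; ≤-trans)
open import Data.Fin using (Fin; toℕ; _≟_)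
import Data.Fin as Fin
open import Data.List using (List; []; _∷_; _++_; _∷ʳ_; take; length; reverse; map; filter; allFin)
open import Data.List.Properties using (++-assoc; ++-identityʳ; reverse-++; reverse-involutive; length-filter)
open import Data.List.Membership.Propositional using (_∈_; _∉_)
open import Data.List.Membership.Propositional.Properties
  using (∈-++⁻; ∈-++⁺ˡ; ∈-++⁺ʳ; ∈-map⁺; ∈-map⁻; ∈-filter⁺; ∈-filter⁻; ∈-allFin)
open import Data.List.Relation.Unary.Any using (here; there)
open import Data.List.Relation.Unary.Any.Properties using (reverse⁺; reverse⁻)
open import Data.List.Relation.Unary.All as All using (All; []; _∷_)
open import Data.List.Relation.Unary.All.Properties using (++⁺)
open import Data.List.Relation.Unary.AllPairs using ([]; _∷_)
open import Data.List.Relation.Unary.Unique.Propositional using (Unique)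
open import Data.List.Relation.Unary.Unique.Propositional.Properties using (allFin⁺)
open import Data.Product using (∃-syntax; _×_; _,_; proj₁; proj₂; map₁)
open import Data.Sum as Sum using (_⊎_; inj₁; inj₂)
open import Data.Unit using (⊤; tt)
open import Data.Empty using (⊥; ⊥-elim)
open import Function using (id; _∘_)
open import Function.Bundles using (_⇔_; mk⇔; Equivalence)
open import Relation.Nullary using (¬_; Dec; yes; no)
open import Relation.Nullary.Decidable using (map′; _×-dec_; _⊎-dec_; ¬?; decidable-stable)
open import Relation.Binary.Definitions using (DecidableEquality)
open import Data.Product.Properties using (≡-dec)
open import Relation.Unary using (Decidable)
open import Relation.Binary.PropositionalEquality using (_≡_; _≢_; refl; sym; trans; cong; subst; subst₂)
open import Relation.Binary.Construct.Closure.ReflexiveTransitive using (Star; ε; _◅_; _◅◅_)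
import Relation.Binary.Construct.Closure.ReflexiveTransitive as Star
open import Relation.Binary.Construct.Closure.Transitive using (TransClosure; [_]; _∷_)

reverse-∷ʳ : ∀ {A : Set} (xs : List A) x → reverse (xs ∷ʳ x) ≡ x ∷ reverse xs
reverse-∷ʳ xs x = reverse-++ xs (x ∷ [])

module _ {n : ℕ} where

  pair-match : ∀ p m q → pair {n} p m · pair m q ≡ pair p q
  pair-match p m q with m ≟ m
  ... | yes _  = refl
  ... | no m≢m = ⊥-elim (m≢m refl)

  ·-pair-inv : ∀ (x y : B n) {p q} → x · y ≡ pair p q → ∃[ j ] (x ≡ pair p j × y ≡ pair j q)
  ·-pair-inv (pair i j) (pair k l) eq with j ≟ k
  ·-pair-inv (pair i j) (pair j l) refl | yes refl = j , refl , refl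

  pair-mismatch : ∀ {i j k l} → j ≢ k → pair {n} i j · pair k l ≡ zero
  pair-mismatch {j = j} {k} j≢k with j ≟ k
  ... | yes j≡k = ⊥-elim (j≢k j≡k)
  ... | no  _   = refl

  ·-assoc : (x y z : B n) → (x · y) · z ≡ x · (y · z)
  ·-assoc zero       y          z          = refl
  ·-assoc (pair i j) zero       z          = refl
  ·-assoc (pair i j) (pair k l) zero with j ≟ k
  ... | yes _ = refl
  ... | no  _ = refl
  ·-assoc (pair i j) (pair k l) (pair m o) = by-cases (j ≟ k) (l ≟ m)
    where
    by-cases : Dec (j ≡ k) → Dec (l ≡ m) →
               (pair i j · pair k l) · pair m o ≡ pair i j · (pair k l · pair m o)
    by-cases (yes refl) (yes refl)
      rewrite pair-match i j l | pair-match j l o = trans (pair-match i l o) (sym (pair-match i j o))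
    by-cases (yes refl) (no l≢m)
      rewrite pair-match i j l | pair-mismatch {i} {l} {m} {o} l≢m | pair-mismatch {j} {l} {m} {o} l≢m = refl
    by-cases (no j≢k) (yes refl)
      rewrite pair-mismatch {i} {j} {k} {l} j≢k | pair-match k l o = sym (pair-mismatch j≢k)
    by-cases (no j≢k) (no l≢m)
      rewrite pair-mismatch {i} {j} {k} {l} j≢k | pair-mismatch {k} {l} {m} {o} l≢m = refl

  prod-++ : ∀ z zs y ys → prod {n} z (zs ++ y ∷ ys) ≡ prod z zs · prod y ys
  prod-++ z []        y ys = refl
  prod-++ z (z′ ∷ zs) y ys =
    trans (cong (z ·_) (prod-++ z′ zs y ys)) (sym (·-assoc z (prod z′ zs) (prod y ys)))

module _ {n : ℕ} where

  Gen-member : ∀ {L x} → x ∈ L → Gen {n} L x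
  Gen-member x∈L = _ , [] , x∈L , [] , refl

  Gen-· : ∀ {L x y} → Gen {n} L x → Gen L y → Gen L (x · y)
  Gen-· (z , zs , z∈ , zs∈ , refl) (y , ys , y∈ , ys∈ , refl) =
    z , zs ++ y ∷ ys , z∈ , ++⁺ zs∈ (y∈ ∷ ys∈) , prod-++ z zs y ys

  Gen-closure : ∀ {L L′} → (∀ {y} → y ∈ L′ → Gen {n} L y) → ∀ {x} → Gen L′ x → Gen L x
  Gen-closure {L} {L′} gen (z , zs , z∈ , zs∈ , refl) = prod-closure z zs z∈ zs∈
    where
    prod-closure : ∀ z zs → z ∈ L′ → All (_∈ L′) zs → Gen L (prod z zs)
    prod-closure z []       z∈ []         = gen z∈
    prod-closure z (y ∷ ys) z∈ (y∈ ∷ ys∈) = Gen-· (gen z∈) (prod-closure y ys y∈ ys∈)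

  Gen-mono : ∀ {L L′} → (∀ {y} → y ∈ L → y ∈ L′) → ∀ {x} → Gen {n} L x → Gen L′ x
  Gen-mono L⊆L′ = Gen-closure (Gen-member ∘ L⊆L′)

  Arc : List (B n) → Fin n → Fin n → Set
  Arc L p q = pair p q ∈ L

  walk⇒Gen : ∀ {L p q} → TransClosure (Arc L) p q → Gen L (pair p q)
  walk⇒Gen [ p→q ] = Gen-member p→q
  walk⇒Gen {L} {p} {q} (_∷_ {y = m} p→m m→⁺q) =
    subst (Gen L) (pair-match p m q) (Gen-· (Gen-member p→m) (walk⇒Gen m→⁺q))

  Gen⇒walk : ∀ {L p q} → Gen L (pair p q) → TransClosure (Arc L) p q
  Gen⇒walk {L} (z , zs , z∈ , zs∈ , eq) = prod⇒walk z zs z∈ zs∈ eq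
    where
    prod⇒walk : ∀ z zs → z ∈ L → All (_∈ L) zs →
                ∀ {p q} → prod z zs ≡ pair p q → TransClosure (Arc L) p q
    prod⇒walk z []       z∈ []         refl = [ z∈ ]
    prod⇒walk z (y ∷ ys) z∈ (y∈ ∷ ys∈) eq with ·-pair-inv z (prod y ys) eq
    ... | _ , refl , eq′ = z∈ ∷ prod⇒walk y ys y∈ ys∈ eq′

  -- A list rs (latest element first) is independent when each element lies
  -- outside the subsemigroup generated by the elements added before it.
  Independent : List (B n) → Set
  Independent []       = ⊤
  Independent (x ∷ rs) = ¬ Gen rs x × Independent rs

  independent-suffix : ∀ rs {rs′} → Independent (rs ++ rs′) → Independent rs′
  independent-suffix []       ind       = ind
  independent-suffix (_ ∷ rs) (_ , ind) = independent-suffix rs ind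

  ChainFrom : List (B n) → List (B n) → Set
  ChainFrom ps xs = (i : Fin (length xs)) →
    Gen (ps ++ take (toℕ i) xs) ⊂ Gen (ps ++ take (suc (toℕ i)) xs)

  adjoin-strict : ∀ ps x → Gen ps ⊂ Gen (ps ∷ʳ x) ⇔ (¬ Gen ps x)
  adjoin-strict ps x = mk⇔ to from
    where
    ps∷ʳx⊆⟨ps⟩ : Gen ps x → ∀ {y} → y ∈ ps ∷ʳ x → Gen ps y
    ps∷ʳx⊆⟨ps⟩ x∈⟨ps⟩ y∈ with ∈-++⁻ ps y∈
    ... | inj₁ y∈ps       = Gen-member y∈ps
    ... | inj₂ (here refl) = x∈⟨ps⟩
    to : Gen ps ⊂ Gen (ps ∷ʳ x) → ¬ Gen ps x
    to (_ , y , y∈ , y∉) x∈⟨ps⟩ = y∉ (Gen-closure (ps∷ʳx⊆⟨ps⟩ x∈⟨ps⟩) y∈)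
    from : ¬ Gen ps x → Gen ps ⊂ Gen (ps ∷ʳ x)
    from x∉ = (λ _ → Gen-mono ∈-++⁺ˡ) , x , Gen-member (∈-++⁺ʳ ps (here refl)) , x∉

  chain-step : ∀ ps x xs → ChainFrom ps (x ∷ xs) ⇔ (¬ Gen ps x × ChainFrom (ps ∷ʳ x) xs)
  chain-step ps x xs = mk⇔ to from
    where
    shift : ∀ m → ps ++ x ∷ take m xs ≡ (ps ∷ʳ x) ++ take m xs
    shift m = sym (++-assoc ps (x ∷ []) (take m xs))
    first : Gen (ps ++ []) ⊂ Gen (ps ∷ʳ x) ≡ Gen ps ⊂ Gen (ps ∷ʳ x)
    first = cong (λ A → Gen A ⊂ Gen (ps ∷ʳ x)) (++-identityʳ ps)
    to : ChainFrom ps (x ∷ xs) → ¬ Gen ps x × ChainFrom (ps ∷ʳ x) xs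
    to c = Equivalence.to (adjoin-strict ps x) (subst id first (c Fin.zero))
         , λ i → subst₂ (λ A C → Gen A ⊂ Gen C) (shift (toℕ i)) (shift (suc (toℕ i))) (c (Fin.suc i))
    from : ¬ Gen ps x × ChainFrom (ps ∷ʳ x) xs → ChainFrom ps (x ∷ xs)
    from (x∉ , c) Fin.zero    = subst id (sym first) (Equivalence.from (adjoin-strict ps x) x∉)
    from (x∉ , c) (Fin.suc i) =
      subst₂ (λ A C → Gen A ⊂ Gen C) (sym (shift (toℕ i))) (sym (shift (suc (toℕ i)))) (c i)

  chain⇒independent : ∀ ps xs → Independent (reverse ps) → ChainFrom ps xs →
                      Independent (reverse (ps ++ xs))
  chain⇒independent ps [] ind _ = subst (Independent ∘ reverse) (sym (++-identityʳ ps)) ind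
  chain⇒independent ps (x ∷ xs) ind c with Equivalence.to (chain-step ps x xs) c
  ... | x∉ , c′ =
    subst (Independent ∘ reverse) (++-assoc ps (x ∷ []) xs) (chain⇒independent (ps ∷ʳ x) xs ind′ c′)
    where
    ind′ : Independent (reverse (ps ∷ʳ x))
    ind′ = subst Independent (sym (reverse-∷ʳ ps x)) (x∉ ∘ Gen-mono reverse⁻ , ind)

  independent⇒chain : ∀ ps xs → Independent (reverse (ps ++ xs)) → ChainFrom ps xs
  independent⇒chain ps []       ind ()
  independent⇒chain ps (x ∷ xs) ind = Equivalence.from (chain-step ps x xs) (x∉ , c′)
    where
    ind′ : Independent (reverse ((ps ∷ʳ x) ++ xs))
    ind′ = subst (Independent ∘ reverse) (sym (++-assoc ps (x ∷ []) xs)) ind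
    x∉ : ¬ Gen ps x
    x∉ = proj₁ (subst Independent (reverse-∷ʳ ps x)
                  (independent-suffix (reverse xs)
                    (subst Independent (reverse-++ (ps ∷ʳ x) xs) ind′)))
         ∘ Gen-mono reverse⁺
    c′ : ChainFrom (ps ∷ʳ x) xs
    c′ = independent⇒chain (ps ∷ʳ x) xs ind′

  chain⇒fresh : ∀ ps xs → ChainFrom ps xs → All (λ y → ¬ Gen ps y) xs
  chain⇒fresh ps []       c = []
  chain⇒fresh ps (x ∷ xs) c with Equivalence.to (chain-step ps x xs) c
  ... | x∉ , c′ = x∉ ∷ All.map (_∘ Gen-mono ∈-++⁺ˡ) (chain⇒fresh (ps ∷ʳ x) xs c′)

  chain⇒unique : ∀ ps xs → ChainFrom ps xs → Unique xs
  chain⇒unique ps []       c = []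
  chain⇒unique ps (x ∷ xs) c with Equivalence.to (chain-step ps x xs) c
  ... | _ , c′ = All.map (λ y∉ x≡y → y∉ (subst (Gen (ps ∷ʳ x)) x≡y x∈))
                         (chain⇒fresh (ps ∷ʳ x) xs c′)
               ∷ chain⇒unique (ps ∷ʳ x) xs c′
    where
    x∈ : Gen (ps ∷ʳ x) x
    x∈ = Gen-member (∈-++⁺ʳ ps (here refl))

Within : {V : Set} → (V → Set) → (V → V → Set) → V → V → Set
Within Q S u v = Q u × Q v × S u v

module Walks {V : Set} {R : V → V → Set} where

  star⇒plus : ∀ {x y} → x ≢ y → Star R x y → TransClosure R x y
  star⇒plus x≢x ε            = ⊥-elim (x≢x refl)
  star⇒plus _   (x→z ◅ z→*y) = plus x→z z→*y
    where
    plus : ∀ {x z y} → R x z → Star R z y → TransClosure R x y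
    plus x→z ε            = [ x→z ]
    plus x→z (z→w ◅ w→*y) = x→z ∷ plus z→w w→*y

  plus⇒star : ∀ {x y} → TransClosure R x y → Star R x y
  plus⇒star [ x→y ]        = x→y ◅ ε
  plus⇒star (x→z ∷ z→⁺y) = x→z ◅ plus⇒star z→⁺y

  star-closed : ∀ {Q : V → Set} → (∀ {x y} → R x y → Q x → Q y) →
                ∀ {x y} → Q x → Star R x y → Q y
  star-closed closed qx ε            = qx
  star-closed closed qx (x→z ◅ z→*y) = star-closed closed (closed x→z qx) z→*y

  module _ {R′ : V → V → Set} {Q : V → Set} where

    star-restrict : (∀ {x y} → Q x → R x y → R′ x y × Q y) →
                    ∀ {x y} → Q x → Star R x y → Star R′ x y
    star-restrict step qx ε            = ε
    star-restrict step qx (x→z ◅ z→*y) with step qx x→z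
    ... | x→′z , qz = x→′z ◅ star-restrict step qz z→*y

    star-restrict-back : (∀ {x y} → Q y → R x y → R′ x y × Q x) →
                         ∀ {x y} → Q y → Star R x y → Star R′ x y × Q x
    star-restrict-back step qy ε            = ε , qy
    star-restrict-back step qy (x→z ◅ z→*y) with star-restrict-back step qy z→*y
    ... | z→′*y , qz with step qz x→z
    ...   | x→′z , qx = x→′z ◅ z→′*y , qx

    plus-restrict : (∀ {x y} → Q x → R x y → R′ x y × Q y) →
                    ∀ {x y} → Q x → TransClosure R x y → TransClosure R′ x y
    plus-restrict step qx [ x→y ]        = [ proj₁ (step qx x→y) ]
    plus-restrict step qx (x→z ∷ z→⁺y) with step qx x→z
    ... | x→′z , qz = x→′z ∷ plus-restrict step qz z→⁺y

    plus-restrict-back : (∀ {x y} → Q y → R x y → R′ x y × Q x) →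
                         ∀ {x y} → Q y → TransClosure R x y → TransClosure R′ x y × Q x
    plus-restrict-back step qy [ x→y ] with step qy x→y
    ... | x→′y , qx = [ x→′y ] , qx
    plus-restrict-back step qy (x→z ∷ z→⁺y) with plus-restrict-back step qy z→⁺y
    ... | z→′⁺y , qz with step qz x→z
    ...   | x→′z , qx = x→′z ∷ z→′⁺y , qx

  module _ {Q : V → Set} (Q? : Decidable Q) where

    entry-step : ∀ {x y} → ¬ Q x → Q y → Star R x y → ∃[ u ] ∃[ v ] (R u v × ¬ Q u × Q v)
    entry-step ¬qx qy ε = ⊥-elim (¬qx qy)
    entry-step ¬qx qy (_◅_ {j = z} x→z z→*y) with Q? z
    ... | yes qz = _ , _ , x→z , ¬qx , qz
    ... | no ¬qz = entry-step ¬qz qy z→*y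

    -- If all steps leaving Q start at the "door" h and all steps entering Q
    -- end at h, then any walk ending in Q can be shortened to a walk inside Q,
    -- starting where the walk last entered Q.
    door-shortcut : (h : V) →
      (∀ {x y} → R x y → Q x → ¬ Q y → x ≡ h) →
      (∀ {x y} → R x y → ¬ Q x → Q y → y ≡ h) →
      ∀ {x y} → Star R x y → Q y →
      (Q x → Star (Within Q R) x y) × (¬ Q x → Star (Within Q R) h y)
    door-shortcut h exit entry ε qy = (λ _ → ε) , (λ ¬qy → ⊥-elim (¬qy qy))
    door-shortcut h exit entry {x} {y} (_◅_ {j = z} x→z z→*y) qy
      with door-shortcut h exit entry z→*y qy | Q? z
    ... | from-z , _ | yes qz =
      (λ qx → (qx , qz , x→z) ◅ from-z qz) ,
      (λ ¬qx → subst (λ v → Star _ v y) (entry x→z ¬qx qz) (from-z qz))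
    ... | _ , from-h | no ¬qz =
      (λ qx → subst (λ v → Star _ v y) (sym (exit x→z qx ¬qz)) (from-h ¬qz)) ,
      (λ _ → from-h ¬qz)

-- Edge sequences over a vertex type with decidable equality.  A list of
-- directed edges is read latest edge first.
module EdgeSequences {V : Set} (_≟ᵥ_ : DecidableEquality V) where
  open Walks

  Edge : Set
  Edge = V × V

  _≟ₑ_ : DecidableEquality Edge
  _≟ₑ_ = ≡-dec _≟ᵥ_ _≟ᵥ_

  open import Data.List.Membership.DecPropositional _≟ₑ_ using (_∈?_)

  Arrow : List Edge → V → V → Set
  Arrow es x y = (x , y) ∈ es

  Reach : List Edge → V → V → Set
  Reach es = Star (Arrow es)

  reach-cons : ∀ s t es {x y} →
    Reach ((s , t) ∷ es) x y ⇔ (Reach es x y ⊎ (Reach es x s × Reach es t y))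
  reach-cons s t es = mk⇔ split join
    where
    split : ∀ {x y} → Reach ((s , t) ∷ es) x y → Reach es x y ⊎ (Reach es x s × Reach es t y)
    split ε = inj₁ ε
    split (here refl ◅ t→*y) = inj₂ (ε , Sum.[ id , proj₂ ] (split t→*y))
    split (there x→z ◅ z→*y) = Sum.map (x→z ◅_) (map₁ (x→z ◅_)) (split z→*y)
    join : ∀ {x y} → Reach es x y ⊎ (Reach es x s × Reach es t y) → Reach ((s , t) ∷ es) x y
    join (inj₁ x→*y)          = Star.map there x→*y
    join (inj₂ (x→*s , t→*y)) = Star.map there x→*s ◅◅ here refl ◅ Star.map there t→*y

  reach? : ∀ es x y → Dec (Reach es x y)
  reach? [] x y with x ≟ᵥ y
  ... | yes refl = yes ε
  ... | no  x≢y  = no λ { ε → x≢y refl ; (() ◅ _) }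
  reach? ((s , t) ∷ es) x y =
    map′ (Equivalence.from (reach-cons s t es)) (Equivalence.to (reach-cons s t es))
      (reach? es x y ⊎-dec (reach? es x s ×-dec reach? es t y))

  Valid : List Edge → Set
  Valid []             = ⊤
  Valid ((p , q) ∷ es) = ¬ Reach es p q × Valid es

  valid-irreflexive : ∀ {es x y} → Valid es → (x , y) ∈ es → x ≢ y
  valid-irreflexive (x↛x , _) (here refl) refl = x↛x ε
  valid-irreflexive {_ ∷ _} (_ , valid) (there e) = valid-irreflexive valid e

  valid-filter : ∀ {Q : Edge → Set} (Q? : Decidable Q) es → Valid es → Valid (filter Q? es)
  valid-filter Q? [] _ = tt
  valid-filter Q? ((p , q) ∷ es) (p↛q , valid) with Q? (p , q)
  ... | yes _ = p↛q ∘ Star.map (proj₁ ∘ ∈-filter⁻ Q?) , valid-filter Q? es valid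
  ... | no  _ = valid-filter Q? es valid

  Admissible : (V → Set) → List Edge → Set
  Admissible P es = Valid es × (∀ {x y} → (x , y) ∈ es → P x × P y)

  Maximal : (V → Set) → List Edge → Set
  Maximal P es = ∀ σ → Admissible P σ → (∀ {e} → e ∈ es → e ∈ σ) → ∀ {e} → e ∈ σ → e ∈ es

  Both : List Edge → V → V → Set
  Both es x y = (x , y) ∈ es × (y , x) ∈ es

  OneWay : List Edge → V → V → Set
  OneWay es x y = (x , y) ∈ es × (y , x) ∉ es

  BothAvoiding : List Edge → V → V → V → V → Set
  BothAvoiding es p q x y = Both es x y × ¬ (x ≡ p × y ≡ q) × ¬ (x ≡ q × y ≡ p)

  avoiding-sym : ∀ {es p q x y} → BothAvoiding es p q x y → BothAvoiding es p q y x
  avoiding-sym ((xy , yx) , not-pq , not-qp) =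
    (yx , xy) , (λ (y≡p , x≡q) → not-qp (x≡q , y≡p)) , (λ (y≡q , x≡p) → not-pq (x≡p , y≡q))

  avoiding-swap : ∀ {es p q x y} → BothAvoiding es p q x y → BothAvoiding es q p x y
  avoiding-swap (both , not-pq , not-qp) = both , not-qp , not-pq

  -- The shape of a maximal admissible sequence: every pair of vertices of P
  -- is joined in some direction, the two-way edges form a tree on P
  -- (connected, and no two-way edge lies on a two-way cycle), and the one-way
  -- edges are acyclic.
  record Structure (P : V → Set) (es : List Edge) : Set where
    field
      total          : ∀ {p q} → P p → P q → p ≢ q → (p , q) ∈ es ⊎ (q , p) ∈ es
      connected      : ∀ {p q} → P p → P q → Star (Both es) p q
      forest         : ∀ {p q} → Both es p q → ¬ Star (BothAvoiding es p q) q p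
      oneWay-acyclic : ∀ v → ¬ TransClosure (OneWay es) v v

  -- Base case: if the empty sequence is maximal, P has at most one vertex.
  structure-[] : ∀ {P} → Maximal P [] → Structure P []
  structure-[] {P} maximal = record
    { total          = total
    ; connected      = connected
    ; forest         = λ { (() , _) }
    ; oneWay-acyclic = λ { _ [ () , _ ] ; _ ((() , _) ∷ _) }
    }
    where
    total : ∀ {p q} → P p → P q → p ≢ q → (p , q) ∈ [] ⊎ (q , p) ∈ []
    total {p} {q} pp pq p≢q with maximal ((p , q) ∷ []) (((λ { ε → p≢q refl ; (() ◅ _) }) , tt) ,
                                   λ { (here refl) → pp , pq })
                                   (λ ()) (here refl)
    ... | ()
    connected : ∀ {p q} → P p → P q → Star (Both []) p q
    connected {p} {q} pp pq with p ≟ᵥ q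
    ... | yes refl = ε
    ... | no p≢q with total pp pq p≢q
    ...   | inj₁ ()
    ...   | inj₂ ()

  -- Concatenating valid lists of these three kinds stays valid,
  -- since a walk that enters U never leaves it again.
  module Cut (U : V → Set) where

    Inside Outside Crossing : List Edge → Set
    Inside   es = ∀ {x y} → (x , y) ∈ es → U x × U y
    Outside  es = ∀ {x y} → (x , y) ∈ es → ¬ U x × ¬ U y
    Crossing es = ∀ {x y} → (x , y) ∈ es → ¬ U x × U y

    valid-++-inside : ∀ {A B} → Inside A → (∀ {x y} → (x , y) ∈ B → ¬ U x) →
                      Valid A → Valid B → Valid (A ++ B)
    valid-++-inside {[]}          inside B-out _             valid-B = valid-B
    valid-++-inside {(p , q) ∷ A} inside B-out (p↛q , valid) valid-B =
      p↛q ∘ star-restrict step (proj₁ (inside (here refl))) ,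
      valid-++-inside (inside ∘ there) B-out valid valid-B
      where
      step : ∀ {x y} → U x → Arrow (A ++ _) x y → Arrow A x y × U y
      step ux e with ∈-++⁻ A e
      ... | inj₁ e-A = e-A , proj₂ (inside (there e-A))
      ... | inj₂ e-B = ⊥-elim (B-out e-B ux)

    valid-++-outside : ∀ {A B} → Outside A → Crossing B → Valid A → Valid B → Valid (A ++ B)
    valid-++-outside {[]}          outside crossing _             valid-B = valid-B
    valid-++-outside {(p , q) ∷ A} outside crossing (p↛q , valid) valid-B =
      p↛q ∘ proj₁ ∘ star-restrict-back step (proj₂ (outside (here refl))) ,
      valid-++-outside (outside ∘ there) crossing valid valid-B
      where
      step : ∀ {x y} → ¬ U y → Arrow (A ++ _) x y → Arrow A x y × ¬ U x
      step ¬uy e with ∈-++⁻ A e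
      ... | inj₁ e-A = e-A , proj₁ (outside (there e-A))
      ... | inj₂ e-B = ⊥-elim (¬uy (proj₂ (crossing e-B)))

    valid-++-cut : ∀ {A B C} → Inside A → Outside B → Crossing C →
                   Valid A → Valid B → Valid C → Valid (A ++ B ++ C)
    valid-++-cut {B = B} inside outside crossing valid-A valid-B valid-C =
      valid-++-inside inside starts-outside valid-A (valid-++-outside outside crossing valid-B valid-C)
      where
      starts-outside : ∀ {x y} → (x , y) ∈ B ++ _ → ¬ U x
      starts-outside e with ∈-++⁻ B e
      ... | inj₁ e-B = proj₁ (outside e-B)
      ... | inj₂ e-C = proj₁ (crossing e-C)

    crossing-walk : ∀ {C} → Crossing C → ∀ {w u} → ¬ U w → U u → Reach C w u → (w , u) ∈ C
    crossing-walk crossing ¬uw uu ε                  = ⊥-elim (¬uw uu)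
    crossing-walk crossing ¬uw uu (w→z ◅ ε)          = w→z
    crossing-walk crossing ¬uw uu (w→z ◅ z→y ◅ _) =
      ⊥-elim (proj₁ (crossing z→y) (proj₂ (crossing w→z)))

  -- The latest edge a → b of an admissible sequence
  -- splits the vertices into U, those reachable from a along the older
  -- edges es′, and its complement W (which contains b).  The older edges lie
  -- inside U, inside W, or cross from W into U; for a maximal sequence both
  -- parts are again maximal and all crossing edges W → U are present.
  module Split (P : V → Set) (a b : V) (es′ : List Edge)
               (admissible : Admissible P ((a , b) ∷ es′))
               (maximal : Maximal P ((a , b) ∷ es′)) where

    es : List Edge
    es = (a , b) ∷ es′

    U : V → Set
    U = Reach es′ a

    U? : Decidable U
    U? = reach? es′ a

    open Cut U

    PU PW : V → Set
    PU v = P v × U v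
    PW v = P v × ¬ U v

    b∉U : ¬ U b
    b∉U = proj₁ (proj₁ admissible)

    U-closed : ∀ {x y} → (x , y) ∈ es′ → U x → U y
    U-closed e ux = ux ◅◅ e ◅ ε

    leaves-U : ∀ {x y} → (x , y) ∈ es → U x → ¬ U y → x ≡ a × y ≡ b
    leaves-U (here refl) _  _   = refl , refl
    leaves-U (there e)   ux ¬uy = ⊥-elim (¬uy (U-closed e ux))

    inside? : Decidable (λ (e : Edge) → U (proj₁ e) × U (proj₂ e))
    inside? (x , y) = U? x ×-dec U? y

    outside? : Decidable (λ (e : Edge) → ¬ U (proj₁ e) × ¬ U (proj₂ e))
    outside? (x , y) = ¬? (U? x) ×-dec ¬? (U? y)

    crossing? : Decidable (λ (e : Edge) → ¬ U (proj₁ e) × U (proj₂ e))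
    crossing? (x , y) = ¬? (U? x) ×-dec U? y

    esU esW cr : List Edge
    esU = filter inside? es′
    esW = filter outside? es′
    cr  = filter crossing? es′

    -- No older edge leaves U, so each lies in one of the three parts.
    classify : ∀ {x y} → (x , y) ∈ es′ → (x , y) ∈ esU ⊎ (x , y) ∈ esW ⊎ (x , y) ∈ cr
    classify {x} {y} e with U? x | U? y
    ... | yes ux | yes uy = inj₁ (∈-filter⁺ inside? e (ux , uy))
    ... | yes ux | no ¬uy = ⊥-elim (¬uy (U-closed e ux))
    ... | no ¬ux | no ¬uy = inj₂ (inj₁ (∈-filter⁺ outside? e (¬ux , ¬uy)))
    ... | no ¬ux | yes uy = inj₂ (inj₂ (∈-filter⁺ crossing? e (¬ux , uy)))

    from-part : ∀ {Q : Edge → Set} (Q? : Decidable Q) {e} → e ∈ filter Q? es′ → e ∈ es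
    from-part Q? = there ∘ proj₁ ∘ ∈-filter⁻ Q?

    into-U : ∀ {x y} → U x → U y → (x , y) ∈ es → (x , y) ∈ esU
    into-U ux uy (here refl) = ⊥-elim (b∉U uy)
    into-U ux uy (there e)   = ∈-filter⁺ inside? e (ux , uy)

    into-W : ∀ {x y} → ¬ U x → ¬ U y → (x , y) ∈ es → (x , y) ∈ esW
    into-W ¬ux ¬uy (here refl) = ⊥-elim (¬ux ε)
    into-W ¬ux ¬uy (there e)   = ∈-filter⁺ outside? e (¬ux , ¬uy)

    endpoints : ∀ {x y} → (x , y) ∈ es → P x × P y
    endpoints = proj₂ admissible

    valid-es′ : Valid es′
    valid-es′ = proj₂ (proj₁ admissible)

    admissible-U : Admissible PU esU
    admissible-U = valid-filter inside? es′ valid-es′ , ends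
      where
      ends : ∀ {x y} → (x , y) ∈ esU → PU x × PU y
      ends e with ∈-filter⁻ inside? e
      ... | e′ , ux , uy = (proj₁ (endpoints (there e′)) , ux) , (proj₂ (endpoints (there e′)) , uy)

    admissible-W : Admissible PW esW
    admissible-W = valid-filter outside? es′ valid-es′ , ends
      where
      ends : ∀ {x y} → (x , y) ∈ esW → PW x × PW y
      ends e with ∈-filter⁻ outside? e
      ... | e′ , ¬ux , ¬uy = (proj₁ (endpoints (there e′)) , ¬ux) , (proj₂ (endpoints (there e′)) , ¬uy)

    crossing-cr : ∀ {x y} → (x , y) ∈ cr → PW x × PU y
    crossing-cr e with ∈-filter⁻ crossing? e
    ... | e′ , ¬ux , uy = (proj₁ (endpoints (there e′)) , ¬ux) , (proj₂ (endpoints (there e′)) , uy)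

    -- The latest edge on top of admissible lists inside U, inside W, and
    -- crossing from W into U is admissible: a walk from a stays in U.
    recombine : ∀ {σU σW σC} → Admissible PU σU → Admissible PW σW →
                Valid σC → (∀ {x y} → (x , y) ∈ σC → PW x × PU y) →
                Admissible P ((a , b) ∷ σU ++ σW ++ σC)
    recombine {σU} {σW} {σC} (valid-U , ends-U) (valid-W , ends-W) valid-C ends-C =
      ((b∉U ∘ star-closed σ-closed ε) , valid-++-cut inside outside crossing valid-U valid-W valid-C) ,
      ends
      where
      inside : Inside σU
      inside e = proj₂ (proj₁ (ends-U e)) , proj₂ (proj₂ (ends-U e))
      outside : Outside σW
      outside e = proj₂ (proj₁ (ends-W e)) , proj₂ (proj₂ (ends-W e))
      crossing : Crossing σC
      crossing e = proj₂ (proj₁ (ends-C e)) , proj₂ (proj₂ (ends-C e))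
      part : ∀ {x y} → (x , y) ∈ σU ++ σW ++ σC → (x , y) ∈ σU ⊎ (x , y) ∈ σW ⊎ (x , y) ∈ σC
      part e = Sum.map₂ (∈-++⁻ σW) (∈-++⁻ σU e)
      σ-closed : ∀ {x y} → (x , y) ∈ σU ++ σW ++ σC → U x → U y
      σ-closed e ux with part e
      ... | inj₁ e-U        = proj₂ (inside e-U)
      ... | inj₂ (inj₁ e-W) = ⊥-elim (proj₁ (outside e-W) ux)
      ... | inj₂ (inj₂ e-C) = proj₂ (crossing e-C)
      ends : ∀ {x y} → (x , y) ∈ (a , b) ∷ σU ++ σW ++ σC → P x × P y
      ends (here refl) = endpoints (here refl)
      ends (there e) with part e
      ... | inj₁ e-U        = proj₁ (proj₁ (ends-U e-U)) , proj₁ (proj₂ (ends-U e-U))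
      ... | inj₂ (inj₁ e-W) = proj₁ (proj₁ (ends-W e-W)) , proj₁ (proj₂ (ends-W e-W))
      ... | inj₂ (inj₂ e-C) = proj₁ (proj₁ (ends-C e-C)) , proj₁ (proj₂ (ends-C e-C))

    -- Replacing the three parts of es′ by admissible supersets yields an
    -- admissible superset of es, hence, by maximality, a subset of es.
    rebuild : ∀ {σU σW σC} → Admissible PU σU → Admissible PW σW →
              Valid σC → (∀ {x y} → (x , y) ∈ σC → PW x × PU y) →
              (∀ {e} → e ∈ esU → e ∈ σU) → (∀ {e} → e ∈ esW → e ∈ σW) →
              (∀ {e} → e ∈ cr → e ∈ σC) →
              ∀ {e} → e ∈ σU ++ σW ++ σC → e ∈ es
    rebuild {σU} {σW} {σC} adm-U adm-W valid-C ends-C sub-U sub-W sub-C =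
      maximal ((a , b) ∷ σU ++ σW ++ σC) (recombine adm-U adm-W valid-C ends-C) es⊆τ ∘ there
      where
      es⊆τ : ∀ {e} → e ∈ es → e ∈ (a , b) ∷ σU ++ σW ++ σC
      es⊆τ (here refl) = here refl
      es⊆τ (there e) with classify e
      ... | inj₁ e-U        = there (∈-++⁺ˡ (sub-U e-U))
      ... | inj₂ (inj₁ e-W) = there (∈-++⁺ʳ σU (∈-++⁺ˡ (sub-W e-W)))
      ... | inj₂ (inj₂ e-C) = there (∈-++⁺ʳ σU (∈-++⁺ʳ σW (sub-C e-C)))

    valid-cr : Valid cr
    valid-cr = valid-filter crossing? es′ valid-es′

    -- Both parts are maximal on their sides: a larger admissible list there
    -- would, by rebuild, consist of edges of es.
    maximal-U : Maximal PU esU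
    maximal-U σ adm sub e∈σ
      with rebuild adm admissible-W valid-cr crossing-cr sub id id (∈-++⁺ˡ e∈σ)
    ... | here refl = ⊥-elim (b∉U (proj₂ (proj₂ (proj₂ adm e∈σ))))
    ... | there e   = ∈-filter⁺ inside? e (proj₂ (proj₁ (proj₂ adm e∈σ)) , proj₂ (proj₂ (proj₂ adm e∈σ)))

    maximal-W : Maximal PW esW
    maximal-W σ adm sub e∈σ
      with rebuild admissible-U adm valid-cr crossing-cr id sub id (∈-++⁺ʳ esU (∈-++⁺ˡ e∈σ))
    ... | here refl = ⊥-elim (proj₂ (proj₁ (proj₂ adm e∈σ)) ε)
    ... | there e   = ∈-filter⁺ outside? e (proj₂ (proj₁ (proj₂ adm e∈σ)) , proj₂ (proj₂ (proj₂ adm e∈σ)))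

    cross-complete : ∀ {w u} → PW w → PU u → (w , u) ∈ es
    cross-complete {w} {u} pw pu with (w , u) ∈? cr
    ... | yes e = from-part crossing? e
    ... | no e∉ = rebuild admissible-U admissible-W (w↛u , valid-cr) ends id id there
                    (∈-++⁺ʳ esU (∈-++⁺ʳ esW (here refl)))
      where
      w↛u : ¬ Reach cr w u
      w↛u = e∉ ∘ crossing-walk (λ e → proj₂ (proj₁ (crossing-cr e)) , proj₂ (proj₂ (crossing-cr e)))
                                (proj₂ pw) (proj₂ pu)
      ends : ∀ {x y} → (x , y) ∈ (w , u) ∷ cr → PW x × PU y
      ends (here refl) = pw , pu
      ends (there e)   = crossing-cr e

    P-a : P a
    P-a = proj₁ (endpoints (here refl))

    P-b : P b
    P-b = proj₂ (endpoints (here refl))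

    ab-both : Both es a b
    ab-both = here refl , cross-complete (P-b , b∉U) (P-a , ε)

    two-way-entry : ∀ {u v} → Both es u v → ¬ U u → U v → u ≡ b × v ≡ a
    two-way-entry (_ , vu) ¬uu uv with leaves-U vu uv ¬uu
    ... | refl , refl = refl , refl

    module Combine (SU : Structure PU esU) (SW : Structure PW esW) where
      private
        module SU = Structure SU
        module SW = Structure SW

      both-U : ∀ {x y} → Both esU x y → Both es x y
      both-U (xy , yx) = from-part inside? xy , from-part inside? yx

      both-W : ∀ {x y} → Both esW x y → Both es x y
      both-W (xy , yx) = from-part outside? xy , from-part outside? yx

      total : ∀ {p q} → P p → P q → p ≢ q → (p , q) ∈ es ⊎ (q , p) ∈ es
      total {p} {q} pp pq p≢q with U? p | U? q
      ... | yes up | yes uq =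
        Sum.map (from-part inside?) (from-part inside?) (SU.total (pp , up) (pq , uq) p≢q)
      ... | no ¬up | no ¬uq =
        Sum.map (from-part outside?) (from-part outside?) (SW.total (pp , ¬up) (pq , ¬uq) p≢q)
      ... | no ¬up | yes uq = inj₁ (cross-complete (pp , ¬up) (pq , uq))
      ... | yes up | no ¬uq = inj₂ (cross-complete (pq , ¬uq) (pp , up))

      connected : ∀ {p q} → P p → P q → Star (Both es) p q
      connected {p} {q} pp pq with U? p | U? q
      ... | yes up | yes uq = Star.map both-U (SU.connected (pp , up) (pq , uq))
      ... | no ¬up | no ¬uq = Star.map both-W (SW.connected (pp , ¬up) (pq , ¬uq))
      ... | yes up | no ¬uq =
        Star.map both-U (SU.connected (pp , up) (P-a , ε)) ◅◅
        ab-both ◅ Star.map both-W (SW.connected (P-b , b∉U) (pq , ¬uq))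
      ... | no ¬up | yes uq =
        Star.map both-W (SW.connected (pp , ¬up) (P-b , b∉U)) ◅◅
        (proj₂ ab-both , proj₁ ab-both) ◅ Star.map both-U (SU.connected (P-a , ε) (pq , uq))

      -- Inside U a detour around a two-way edge would, after cutting out its
      -- excursions through the door a, be a detour inside U; likewise in W
      -- with the door b.
      forest-U : ∀ {p q} → U p → U q → Both es p q → ¬ Star (BothAvoiding es p q) q p
      forest-U {p} {q} up uq (pq , qp) q→*p =
        SU.forest (into-U up uq pq , into-U uq up qp)
          (Star.map restrict (proj₁ (door-shortcut U? a exit entry q→*p up) uq))
        where
        exit : ∀ {x y} → BothAvoiding es p q x y → U x → ¬ U y → x ≡ a
        exit ((xy , _) , _) ux ¬uy = proj₁ (leaves-U xy ux ¬uy)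
        entry : ∀ {x y} → BothAvoiding es p q x y → ¬ U x → U y → y ≡ a
        entry ((_ , yx) , _) ¬ux uy = proj₁ (leaves-U yx uy ¬ux)
        restrict : ∀ {x y} → Within U (BothAvoiding es p q) x y → BothAvoiding esU p q x y
        restrict (ux , uy , (xy , yx) , avoid) = (into-U ux uy xy , into-U uy ux yx) , avoid

      forest-W : ∀ {p q} → ¬ U p → ¬ U q → Both es p q → ¬ Star (BothAvoiding es p q) q p
      forest-W {p} {q} ¬up ¬uq (pq , qp) q→*p =
        SW.forest (into-W ¬up ¬uq pq , into-W ¬uq ¬up qp)
          (Star.map restrict (proj₁ (door-shortcut (¬? ∘ U?) b exit entry q→*p ¬up) ¬uq))
        where
        exit : ∀ {x y} → BothAvoiding es p q x y → ¬ U x → ¬ ¬ U y → x ≡ b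
        exit ((_ , yx) , _) ¬ux ¬¬uy = proj₂ (leaves-U yx (decidable-stable (U? _) ¬¬uy) ¬ux)
        entry : ∀ {x y} → BothAvoiding es p q x y → ¬ ¬ U x → ¬ U y → y ≡ b
        entry ((xy , _) , _) ¬¬ux ¬uy = proj₂ (leaves-U xy (decidable-stable (U? _) ¬¬ux) ¬uy)
        restrict : ∀ {x y} → Within (¬_ ∘ U) (BothAvoiding es p q) x y → BothAvoiding esW p q x y
        restrict (¬ux , ¬uy , (xy , yx) , avoid) = (into-W ¬ux ¬uy xy , into-W ¬uy ¬ux yx) , avoid

      -- An edge from U to W is a — b, and a walk back into U must use b — a.
      forest-across : ∀ {p q} → (p , q) ∈ es → U p → ¬ U q → ¬ Star (BothAvoiding es p q) q p
      forest-across pq up ¬uq q→*p with leaves-U pq up ¬uq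
      ... | refl , refl with entry-step U? ¬uq up q→*p
      ...   | u , v , (uv , _ , not-qp) , ¬uu , uv∈U with two-way-entry uv ¬uu uv∈U
      ...     | refl , refl = not-qp (refl , refl)

      forest : ∀ {p q} → Both es p q → ¬ Star (BothAvoiding es p q) q p
      forest {p} {q} (pq , qp) q→*p with U? p | U? q
      ... | yes up | yes uq = forest-U up uq (pq , qp) q→*p
      ... | no ¬up | no ¬uq = forest-W ¬up ¬uq (pq , qp) q→*p
      ... | yes up | no ¬uq = forest-across pq up ¬uq q→*p
      ... | no ¬up | yes uq =
        forest-across qp uq ¬up (Star.map avoiding-swap (Star.reverse avoiding-sym q→*p))

      -- One-way edges never leave U, so a one-way cycle stays on one side.
      oneWay-U : ∀ {x y} → U x → OneWay es x y → OneWay esU x y × U y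
      oneWay-U {x} {y} ux (xy , yx∉) with U? y
      ... | yes uy = (into-U ux uy xy , yx∉ ∘ from-part inside?) , uy
      ... | no ¬uy with leaves-U xy ux ¬uy
      ...   | refl , refl = ⊥-elim (yx∉ (proj₂ ab-both))

      oneWay-W : ∀ {x y} → ¬ U y → OneWay es x y → OneWay esW x y × ¬ U x
      oneWay-W {x} {y} ¬uy (xy , yx∉) with U? x
      ... | no ¬ux = (into-W ¬ux ¬uy xy , yx∉ ∘ from-part outside?) , ¬ux
      ... | yes ux with leaves-U xy ux ¬uy
      ...   | refl , refl = ⊥-elim (yx∉ (proj₂ ab-both))

      oneWay-acyclic : ∀ v → ¬ TransClosure (OneWay es) v v
      oneWay-acyclic v cycle with U? v
      ... | yes uv = SU.oneWay-acyclic v (plus-restrict oneWay-U uv cycle)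
      ... | no ¬uv = SW.oneWay-acyclic v (proj₁ (plus-restrict-back oneWay-W ¬uv cycle))

      structure : Structure P es
      structure = record
        { total = total ; connected = connected ; forest = forest ; oneWay-acyclic = oneWay-acyclic }

  structure : ∀ k {P} es → length es ≤ k → Admissible P es → Maximal P es → Structure P es
  structure k       []              _         _          maximal = structure-[] maximal
  structure (suc k) ((a , b) ∷ es′) (s≤s len) admissible maximal =
    Combine.structure
      (structure k esU (≤-trans (length-filter inside? es′) len) admissible-U maximal-U)
      (structure k esW (≤-trans (length-filter outside? es′) len) admissible-W maximal-W)
    where open Split _ a b es′ admissible maximal

module _ {n : ℕ} where
  open EdgeSequences (_≟_ {n})
  open Walks

  edges : List (B n) → List Edge
  edges []             = []
  edges (zero ∷ L)     = edges L
  edges (pair p q ∷ L) with p ≟ q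
  ... | yes _ = edges L
  ... | no  _ = (p , q) ∷ edges L

  edges⁻ : ∀ L {p q} → (p , q) ∈ edges L → pair p q ∈ L × p ≢ q
  edges⁻ (zero ∷ L)     e = map₁ there (edges⁻ L e)
  edges⁻ (pair p q ∷ L) e with p ≟ q | e
  ... | yes _   | e′          = map₁ there (edges⁻ L e′)
  ... | no  p≢q | here refl   = here refl , p≢q
  ... | no  _   | there e′    = map₁ there (edges⁻ L e′)

  edges⁺ : ∀ L {p q} → pair p q ∈ L → p ≢ q → (p , q) ∈ edges L
  edges⁺ (pair p q ∷ L) (here refl) p≢q with p ≟ q
  ... | yes p≡q = ⊥-elim (p≢q p≡q)
  ... | no  _   = here refl
  edges⁺ (zero ∷ L)     (there m) p≢q = edges⁺ L m p≢q
  edges⁺ (pair i j ∷ L) (there m) p≢q with i ≟ j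
  ... | yes _ = edges⁺ L m p≢q
  ... | no  _ = there (edges⁺ L m p≢q)

  -- The edges of an independent list form a valid sequence: a path p →* q
  -- through earlier edges would generate (p , q).
  independent⇒valid : ∀ rs → Independent rs → Valid (edges rs)
  independent⇒valid []             _         = tt
  independent⇒valid (zero ∷ rs)    (_ , ind) = independent⇒valid rs ind
  independent⇒valid (pair p q ∷ rs) (p,q∉ , ind) with p ≟ q
  ... | yes _   = independent⇒valid rs ind
  ... | no  p≢q =
    (λ p→*q → p,q∉ (walk⇒Gen (star⇒plus p≢q (Star.map (proj₁ ∘ edges⁻ rs) p→*q)))) ,
    independent⇒valid rs ind

  -- Conversely, a valid sequence σ yields the independent list consisting
  -- of 0, then the idempotents (i , i), then the pairs of σ.
  diag : Fin n → B n
  diag i = pair i i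

  toPair : Edge → B n
  toPair (p , q) = pair p q

  idempotents : List (B n)
  idempotents = map diag (allFin n) ++ zero ∷ []

  members : List Edge → List (B n)
  members σ = map toPair σ ++ idempotents

  idempotent-diag : ∀ {i j} → E (pair {n} i j) → i ≡ j
  idempotent-diag e with ·-pair-inv _ _ e
  ... | _ , refl , refl = refl

  idempotents-loops : ∀ {u v} → pair u v ∈ idempotents → u ≡ v
  idempotents-loops m with ∈-++⁻ (map diag (allFin n)) m
  ... | inj₂ (here ())
  ... | inj₁ m′ with ∈-map⁻ diag m′
  ...   | _ , _ , refl = refl

  independent-idempotents : ∀ L → Unique L → Independent (map diag L ++ zero ∷ [])
  independent-idempotents []      _            = (λ { (_ , _ , () , _) }) , tt
  independent-idempotents (i ∷ L) (i∉L ∷ uniq) = i,i∉ , independent-idempotents L uniq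
    where
    first-step : ∀ {m} → pair i m ∈ map diag L ++ zero ∷ [] → ⊥
    first-step s with ∈-++⁻ (map diag L) s
    ... | inj₂ (here ())
    ... | inj₁ s′ with ∈-map⁻ diag s′
    ...   | j , j∈L , refl = All.lookup i∉L j∈L refl
    i,i∉ : ¬ Gen (map diag L ++ zero ∷ []) (pair i i)
    i,i∉ g with Gen⇒walk g
    ... | [ s ]   = first-step s
    ... | s ∷ _   = first-step s

  -- Pairs of a valid σ are not generated by earlier pairs and idempotents,
  -- since idempotent pairs are loops that a walk can skip.
  independent-members : ∀ σ → Valid σ → Independent (members σ)
  independent-members []             _ =
    independent-idempotents (allFin n) (allFin⁺ n)
  independent-members ((p , q) ∷ σ) (p↛q , valid) =
    p↛q ∘ skip-loops ∘ plus⇒star ∘ Gen⇒walk , independent-members σ valid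
    where
    skip-loops : ∀ {u v} → Star (Arc (members σ)) u v → Reach σ u v
    skip-loops ε = ε
    skip-loops (s ◅ w) with ∈-++⁻ (map toPair σ) s
    ... | inj₂ s′ with idempotents-loops s′
    ...   | refl = skip-loops w
    skip-loops (s ◅ w) | inj₁ s′ with ∈-map⁻ toPair s′
    ...   | _ , uv∈σ , refl = uv∈σ ◅ skip-loops w

  Face : List Edge → SubsetB n
  Face σ x = x ∈ reverse (members σ)

  face : ∀ σ → Valid σ → IsFace (Face σ)
  face σ valid = xs , (chain⇒unique [] xs chain , λ _ → mk⇔ id id) , chain
    where
    xs : List (B n)
    xs = reverse (members σ)
    chain : StrictChain xs
    chain = independent⇒chain [] xs
              (subst Independent (sym (reverse-involutive (members σ))) (independent-members σ valid))

  -- A cycle v₀ v₁ … vₖ of two-way edges contains a two-way walk from v₁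
  -- back to v₀ that avoids the edge v₀ — v₁.
  cycle-detour : ∀ {es v₀ v₁} w ws → CycleFrom (Both es) v₀ w ws → w ≢ v₀ →
                 All (v₀ ≢_) ws → All (v₁ ≢_) ws → (ws ≡ [] → w ≢ v₁) →
                 Star (BothAvoiding es v₀ v₁) w v₀
  cycle-detour w [] w→v₀ w≢v₀ [] [] last =
    (w→v₀ , (λ (w≡v₀ , _) → w≢v₀ w≡v₀) , (λ (w≡v₁ , _) → last refl w≡v₁)) ◅ ε
  cycle-detour w (u ∷ us) (w→u , rest) w≢v₀ (v₀≢u ∷ v₀∉us) (v₁≢u ∷ v₁∉us) _ =
    (w→u , (λ (w≡v₀ , _) → w≢v₀ w≡v₀) , (λ (_ , u≡v₀) → v₀≢u (sym u≡v₀))) ◅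
    cycle-detour u us rest (v₀≢u ∘ sym) v₀∉us v₁∉us (λ _ u≡v₁ → v₁≢u (sym u≡v₁))

  two-way-acyclic : ∀ {es} → (∀ {p q} → Both es p q → ¬ Star (BothAvoiding es p q) q p) →
                    ¬ HasCycle (Both es)
  two-way-acyclic forest (_ , []         , ()      , _)
  two-way-acyclic forest (_ , _ ∷ []     , s≤s () , _)
  two-way-acyclic forest (v₀ , v₁ ∷ v₂ ∷ vs , _ , ((v₀≢v₁ ∷ v₀∉) ∷ (v₁∉ ∷ _)) , v₀→v₁ , rest) =
    forest v₀→v₁ (cycle-detour v₁ (v₂ ∷ vs) rest (v₀≢v₁ ∘ sym) v₀∉ v₁∉ (λ ()))

  -- A facet F, enumerated by a strict chain xs.  The edges among its
  -- elements form a maximal admissible sequence, because every valid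
  -- extension σ of them yields a face containing F.
  module FacetEdges (F : SubsetB n) (xs : List (B n)) (enum : ∀ x → F x ⇔ (x ∈ xs))
                    (chain : StrictChain xs)
                    (maximal-F : (Y : SubsetB n) → IsFace Y → F ⊆ Y → Y ⊆ F) where
    open import Data.List.Membership.DecPropositional _≟ₑ_ using (_∈?_)

    rs : List (B n)
    rs = reverse xs

    F⇒rs : ∀ {x} → F x → x ∈ rs
    F⇒rs {x} = reverse⁺ ∘ Equivalence.to (enum x)

    rs⇒F : ∀ {x} → x ∈ rs → F x
    rs⇒F {x} = Equivalence.from (enum x) ∘ reverse⁻

    es : List Edge
    es = edges rs

    valid-es : Valid es
    valid-es = independent⇒valid rs (chain⇒independent [] xs tt chain)

    -- F lies in the face built from any superset σ of es ...
    F⊆Face : ∀ σ → (∀ {e} → e ∈ es → e ∈ σ) → F ⊆ Face σ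
    F⊆Face σ sub zero _ =
      reverse⁺ (∈-++⁺ʳ (map toPair σ) (∈-++⁺ʳ (map diag (allFin n)) (here refl)))
    F⊆Face σ sub (pair p q) f with p ≟ q
    ... | yes refl = reverse⁺ (∈-++⁺ʳ (map toPair σ) (∈-++⁺ˡ (∈-map⁺ diag (∈-allFin p))))
    ... | no  p≢q  = reverse⁺ (∈-++⁺ˡ (∈-map⁺ toPair (sub (edges⁺ rs (F⇒rs f) p≢q))))

    -- ... so, when σ is valid, maximality of F gives the converse.
    members⊆F : ∀ σ → Valid σ → (∀ {e} → e ∈ es → e ∈ σ) → ∀ {x} → x ∈ members σ → F x
    members⊆F σ valid sub {x} m = maximal-F (Face σ) (face σ valid) (F⊆Face σ sub) x (reverse⁺ m)

    maximal-es : Maximal (λ _ → ⊤) es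
    maximal-es σ (valid , _) sub e∈σ =
      edges⁺ rs (F⇒rs (members⊆F σ valid sub (∈-++⁺ˡ (∈-map⁺ toPair e∈σ))))
                (valid-irreflexive valid e∈σ)

    F-idempotent : ∀ {x} → x ∈ idempotents → F x
    F-idempotent m = members⊆F es valid-es id (∈-++⁺ʳ (map toPair es) m)

    open Structure (structure (length es) es ≤-refl (valid-es , λ _ → tt , tt) maximal-es)

    T O : Fin n → Fin n → Set
    T = Both es
    O = OneWay es

    spanning-tree : IsSpanningTree n T
    spanning-tree =
      ((λ _ _ (pq , qp) → qp , pq) , (λ _ (pp , _) → valid-irreflexive valid-es pp refl)) ,
      (λ _ _ (pq , _) → valid-irreflexive valid-es pq) ,
      (λ _ _ → connected tt tt) ,
      two-way-acyclic forest

    orientation : IsOrientation (K n ∖ T) O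
    orientation =
      (λ _ _ (pq , qp∉) → valid-irreflexive valid-es pq , λ (_ , qp) → qp∉ qp) ,
      (λ _ _ (_ , qp∉) (qp , _) → ⊥-elim (qp∉ qp)) ,
      λ _ _ (p≢q , ¬T) → Sum.map (λ pq → pq , λ qp → ¬T (pq , qp))
                                 (λ qp → qp , λ pq → ¬T (pq , qp))
                                 (total tt tt p≢q)

    acyclic : IsAcyclic O
    acyclic = oneWay-acyclic

    shape : ∀ x → F x ⇔ FacetShape T O x
    shape x = mk⇔ (to x) (from x)
      where
      to : ∀ x → F x → FacetShape T O x
      to zero       _ = inj₁ refl
      to (pair p q) f with p ≟ q
      ... | yes refl = inj₁ (pair-match p p p)
      ... | no  p≢q with (q , p) ∈? es
      ...   | yes qp  = inj₂ (inj₁ (p , q , refl , edges⁺ rs (F⇒rs f) p≢q , qp))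
      ...   | no  qp∉ = inj₂ (inj₂ (p , q , refl , edges⁺ rs (F⇒rs f) p≢q , qp∉))
      from : ∀ x → FacetShape T O x → F x
      from zero       _        = F-idempotent (∈-++⁺ʳ (map diag (allFin n)) (here refl))
      from (pair i j) (inj₁ e) with idempotent-diag e
      ... | refl = F-idempotent (∈-++⁺ˡ (∈-map⁺ diag (∈-allFin i)))
      from _ (inj₂ (inj₁ (_ , _ , refl , pq , _))) = rs⇒F (proj₁ (edges⁻ rs pq))
      from _ (inj₂ (inj₂ (_ , _ , refl , pq , _))) = rs⇒F (proj₁ (edges⁻ rs pq))

-- Proposition 5.16.
proposition5p16 : (n : ℕ) → 1 ≤ n → (F : SubsetB n) → IsFacet F →
    ∃[ T ] ∃[ O ] (IsSpanningTree n T × IsOrientation (K n ∖ T) O × IsAcyclic O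
      × (∀ x → F x ⇔ FacetShape T O x))
proposition5p16 n _ F ((xs , (_ , enum) , chain) , maximal) =
  T , O , spanning-tree , orientation , acyclic , shape
  where open FacetEdges F xs enum chain maximal
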